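{- Let $T$ be a binary tree with leaf set $X$ of size $n$, $\rho$ a ranking of $X$, $\tau=(r,r+1)$ an adjacent-rank transposition, and let $\ell_{\mathrm{lo}}=\rho^{ -1}(r)$ and $\ell_{\mathrm{hi}}=\rho^{ -1}(r+1)$ be the affected leaves. Let $v$ be the lowest common ancestor of $\ell_{\mathrm{lo}}$ and $\ell_{\mathrm{hi}}$, let $u_{\mathrm{lo}}$ and $u_{\mathrm{hi}}$ be the children of $v$ whose subtrees contain $\ell_{\mathrm{lo}}$ and $\ell_{\mathrm{hi}}$ respectively, and let $L_{\mathrm{lo}}$, $L_{\mathrm{hi}}$ be the leaf sets of these subtrees. Write $L_{\mathrm{lo}}=\{\ell_{\mathrm{lo}}\}\sqcup A$ with $A=A_<\sqcup A_>$, where $A_<$ (resp. $A_>$) consists of the leaves of $A$ with $\rho$-rank less (resp. greater) than $\rho(\ell_{\mathrm{lo}})$, and similarly $L_{\mathrm{hi}}=\{\ell_{\mathrm{hi}}\}\sqcup B$, $B=B_<\sqcup B_>$ relative to $\rho(\ell_{\mathrm{hi}})$. Then $$\mathrm{MInv}(T,\rho)=\mathrm{MInv}(T,\tau\rho)\iff \mathrm{DInv}_\rho(L_{\mathrm{lo}},L_{\mathrm{hi}})=\mathrm{DInv}_\rho(\{\ell_{\mathrm{lo}}\},\{\ell_{\mathrm{hi}}\})\iff \mathrm{DInv}_\rho(A,B)=|A_<|-|A_>|+|B_>|-|B_<|.$$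
   Context: A ranking of $X$ is a bijection $\rho:X\to\{1,\dots,n\}$. An adjacent-rank transposition is a permutation $\tau=(r,r+1)$ of $\{1,\dots,n\}$ with $r\in\{1,\dots,n-1\}$, and $\tau\rho$ denotes the ranking $x\mapsto\tau(\rho(x))$. For $A,B\subseteq X$, $\mathrm{XInv}_\rho(A,B)$ is the number of pairs $(x_1,x_2)\in A\times B$ with $\rho(x_1)>\rho(x_2)$, and $\mathrm{DInv}_\rho(A,B)=\mathrm{XInv}_\rho(A,B)-\mathrm{XInv}_\rho(B,A)$. An ordering of $T$ (left-to-right order of children at each internal node) induces a left-to-right ranking $\sigma$ of $X$; $\mathrm{MInv}(T,\rho)$ is the minimum over orderings of the number of pairs $x_1,x_2$ with $\rho(x_1)<\rho(x_2)$ and $\sigma(x_1)>\sigma(x_2)$. A binary tree is a rooted tree in which every node has at most two children. -}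

module Defs where

open import Data.Nat using (ℕ; zero; suc; _<_; _⊓_)
open import Data.Integer as ℤ using (ℤ)
open import Data.Fin using (Fin; fromℕ<) renaming (_<_ to _<ᶠ_; _≟_ to _≟ᶠ_)
open import Data.Fin.Properties using () renaming (_<?_ to _<ᶠ?_)
open import Data.Fin.Permutation using (Permutation′; _⟨$⟩ʳ_; _⟨$⟩ˡ_; _∘ₚ_; transpose)
open import Data.List using (List; []; _∷_; [_]; _++_; length; filter; concatMap; map; foldr)
open import Data.List.Membership.Propositional using (_∈_)
open import Relation.Nullary using (¬_)
open import Relation.Nullary.Decidable using (¬?)
open import Relation.Binary.PropositionalEquality using (_≡_)

data Tree (n : ℕ) : Set where
  leaf  : Fin n → Tree n
  node1 : Tree n → Tree n
  node2 : Tree n → Tree n → Tree n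

leaves : ∀ {n} → Tree n → List (Fin n)
leaves (leaf x)    = [ x ]
leaves (node1 t)   = leaves t
leaves (node2 s t) = leaves s ++ leaves t

data ChildOf {n : ℕ} : Tree n → Tree n → Set where
  child1  : ∀ {t}   → ChildOf t (node1 t)
  child2l : ∀ {s t} → ChildOf s (node2 s t)
  child2r : ∀ {s t} → ChildOf t (node2 s t)

-- u ⊑ t : u is (the subtree rooted at) a node of t
data _⊑_ {n : ℕ} : Tree n → Tree n → Set where
  here  : ∀ {t} → t ⊑ t
  below : ∀ {u c t} → u ⊑ c → ChildOf c t → u ⊑ t

record IsLCA {n : ℕ} (T v : Tree n) (a b : Fin n) : Set where
  field
    isNode  : v ⊑ T
    hasA    : a ∈ leaves v
    hasB    : b ∈ leaves v
    lowest  : ∀ w → w ⊑ T → a ∈ leaves w → b ∈ leaves w → v ⊑ w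

-- Rankings: bijections X → {0,…,n-1} (ranks shifted by one w.r.t. the paper)
Ranking : ℕ → Set
Ranking n = Permutation′ n

-- the ranking τρ, x ↦ τ(ρ(x)), for τ = (i j)
_·_ : ∀ {n} → Permutation′ n → Ranking n → Ranking n
τ · ρ = ρ ∘ₚ τ

orderings : ∀ {n} → Tree n → List (List (Fin n))
orderings (leaf x)    = [ [ x ] ]
orderings (node1 t)   = orderings t
orderings (node2 s t) =
  concatMap (λ σs → concatMap (λ σt → (σs ++ σt) ∷ (σt ++ σs) ∷ []) (orderings t)) (orderings s)

inversions : ∀ {n} → Ranking n → List (Fin n) → ℕ
inversions ρ []       = 0
inversions ρ (x ∷ xs) = length (filter (λ y → (ρ ⟨$⟩ʳ y) <ᶠ? (ρ ⟨$⟩ʳ x)) xs) + inversions ρ xs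
  where open Data.Nat using (_+_)

minList : List ℕ → ℕ
minList []       = 0
minList (m ∷ ms) = foldr _⊓_ m ms

MInv : ∀ {n} → Tree n → Ranking n → ℕ
MInv T ρ = minList (map (inversions ρ) (orderings T))

XInv : ∀ {n} → Ranking n → List (Fin n) → List (Fin n) → ℕ
XInv ρ A B = length (concatMap (λ x1 → filter (λ x2 → (ρ ⟨$⟩ʳ x2) <ᶠ? (ρ ⟨$⟩ʳ x1)) B) A)

DInv : ∀ {n} → Ranking n → List (Fin n) → List (Fin n) → ℤ
DInv ρ A B = (ℤ.+ XInv ρ A B) ℤ.- (ℤ.+ XInv ρ B A)

remove : ∀ {n} → Fin n → List (Fin n) → List (Fin n)
remove ℓ L = filter (λ y → ¬? (y ≟ᶠ ℓ)) L

below< : ∀ {n} → Ranking n → Fin n → List (Fin n) → List (Fin n)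
below< ρ ℓ L = filter (λ y → (ρ ⟨$⟩ʳ y) <ᶠ? (ρ ⟨$⟩ʳ ℓ)) L

above> : ∀ {n} → Ranking n → Fin n → List (Fin n) → List (Fin n)
above> ρ ℓ L = filter (λ y → (ρ ⟨$⟩ʳ ℓ) <ᶠ? (ρ ⟨$⟩ʳ y)) L

-- MInv is computed bottom-up: at a binary node with children s and t it is
-- MInv s + MInv t + min (XInv(s,t), XInv(t,s)).  Swapping the adjacent ranks r, r+1 only
-- changes the relative order of the pair ℓlo, ℓhi, so every subtree not containing both
-- keeps its MInv and every cross count between such subtrees is unchanged; hence MInv T
-- changes exactly when MInv changes at the lowest common ancestor v.  At v,
-- with k₁, k₂ the crossings between Llo and Lhi other than the pair itself, the two cross
-- counts are k₁ and k₂ + 1 before the swap and k₁ + 1 and k₂ after it, and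
-- min (k₁, k₂ + 1) = min (k₁ + 1, k₂) holds exactly when k₁ = k₂, i.e. when
-- DInv(Llo, Lhi) = DInv({ℓlo}, {ℓhi}).  Since no rank lies strictly between those of ℓlo
-- and ℓhi, the crossings of ℓlo with B are counted by B_<, those of A with ℓhi by A_>
-- (and symmetrically), which turns k₁ = k₂ into the identity for DInv(A, B).
module Submission where

open import Defs
open import Data.Nat using (ℕ; suc; _<_)
open import Data.Nat.Properties using (<-trans; n<1+n)
open import Data.Integer as ℤ using (ℤ)
open import Data.Fin using (Fin; fromℕ<)
open import Data.Fin.Permutation using (_⟨$⟩ˡ_; transpose)
open import Data.List using (List; [_]; length; allFin)
open import Data.List.Membership.Propositional using (_∈_)
open import Data.List.Relation.Binary.Permutation.Propositional using (_↭_)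
open import Data.Product using (_×_)
open import Function.Bundles using (_⇔_)
open import Relation.Binary.PropositionalEquality using (_≡_)

open import Data.Nat using (zero; _+_; _≤_; _⊓_; s≤s)
open import Data.Nat.Properties
  using ( +-identityʳ; +-comm; +-assoc; +-cancelˡ-≡; +-cancelʳ-≡; +-mono-≤; suc-injective
        ; ≤-refl; ≤-reflexive; ≤-trans; ≤-antisym; ≤-pred; <⇒≤; <-irrefl; <-asym; ≤-<-trans
        ; ≤∧≢⇒<; m<n⇒m<1+n; n≤1+n; m≤m+n; m≤n+m
        ; ⊓-sel; ⊓-comm; m⊓n≤m; m⊓n≤n; m≤n⇒m⊓o≤n; m≤n⇒o⊓m≤n; m≤n⇒m⊓n≡m; m≥n⇒m⊓n≡n )
open import Data.Nat.ListAction using (sum)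
open import Data.Nat.ListAction.Properties using (sum-↭; sum-++)
import Data.Nat.Tactic.RingSolver as ℕ-Solver
open import Data.Integer.Properties using (pos-+) renaming (+-injective to pos-injective)
open import Data.Integer.Tactic.RingSolver using (solve-∀)
open import Data.Bool using (true; false)
open import Data.Empty using (⊥-elim)
open import Data.Fin using (toℕ) renaming (_<_ to _<ᶠ_)
open import Data.Fin.Properties using (toℕ-injective; toℕ-fromℕ<) renaming (_<?_ to _<ᶠ?_; _≟_ to _≟ᶠ_)
open import Data.Fin.Permutation using (_⟨$⟩ʳ_; inverseˡ; inverseʳ)
import Data.Fin.Permutation.Components as PC
open import Data.List using ([]; _∷_; _++_; filter; map)
open import Data.List.Properties
  using (length-++; filter-++; filter-accept; filter-reject; filter-all; map-++; foldr-preservesᵒ)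
open import Data.List.Membership.Propositional using (_∉_; find; lose)
open import Data.List.Membership.Propositional.Properties
  using (foldr-selective; ∈-concatMap⁺; ∈-concatMap⁻; ∈-map⁺; ∈-map⁻; ∈-filter⁻; ∈-++⁺ˡ; ∈-++⁺ʳ)
open import Data.List.Relation.Unary.Any as Any using (Any; here; there)
import Data.List.Relation.Unary.All as All
import Data.List.Relation.Unary.All.Properties as All
open import Data.List.Relation.Unary.AllPairs using ([]; _∷_)
open import Data.List.Relation.Unary.Unique.Propositional using (Unique)
open import Data.List.Relation.Unary.Unique.Propositional.Properties using (allFin⁺)
open import Data.List.Relation.Binary.Disjoint.Propositional using (Disjoint)
open import Data.List.Relation.Binary.Permutation.Propositional
  using (↭-refl; ↭-reflexive; ↭-sym; ↭-trans; ↭-prep; ↭-swap; ↭⇒↭ₛ)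
open import Data.List.Relation.Binary.Permutation.Propositional.Properties
  using (filter-↭; ↭-length; map⁺; ++⁺; ++-comm)
import Data.List.Relation.Binary.Permutation.Setoid.Properties as PermutationSetoid
open import Data.Product as Product using (_,_; proj₁; proj₂; ∃; ∃₂; swap)
open import Data.Sum using (_⊎_; inj₁; inj₂; [_,_]′)
open import Function using (_∘_)
open import Function.Bundles using (mk⇔; Equivalence)
open import Function.Construct.Identity using (⇔-id)
open import Function.Construct.Symmetry using (⇔-sym)
open import Function.Construct.Composition using () renaming (equivalence to ⇔-trans)
open import Function.Related.Propositional using (module EquationalReasoning)
open import Level using (Level)
open import Relation.Nullary using (¬_; yes; no; does; contradiction)
open import Relation.Nullary.Decidable using (¬?; dec-true; dec-false)
open import Relation.Unary using (Pred; Decidable)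
open import Relation.Binary.PropositionalEquality
  using (_≢_; refl; sym; trans; cong; cong₂; subst; subst₂; setoid; module ≡-Reasoning)

private variable
  a p q : Level
  X : Set a

count : {P : Pred X p} → Decidable P → List X → ℕ
count P? xs = length (filter P? xs)

count-++ : {P : Pred X p} (P? : Decidable P) (xs ys : List X) →
           count P? (xs ++ ys) ≡ count P? xs + count P? ys
count-++ P? xs ys = trans (cong length (filter-++ P? xs ys)) (length-++ (filter P? xs))

count-↭ : {P : Pred X p} (P? : Decidable P) {xs ys : List X} → xs ↭ ys → count P? xs ≡ count P? ys
count-↭ P? xs↭ys = ↭-length (filter-↭ P? xs↭ys)

count-cong : {P : Pred X p} {Q : Pred X q} (P? : Decidable P) (Q? : Decidable Q) (xs : List X) →
             (∀ {x} → x ∈ xs → P x ⇔ Q x) → count P? xs ≡ count Q? xs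
count-cong P? Q? []       P⇔Q = refl
count-cong P? Q? (x ∷ xs) P⇔Q with P? x | Q? x
... | yes px | yes qx = cong suc (count-cong P? Q? xs (P⇔Q ∘ there))
... | yes px | no ¬qx = contradiction (Equivalence.to (P⇔Q (here refl)) px) ¬qx
... | no ¬px | yes qx = contradiction (Equivalence.from (P⇔Q (here refl)) qx) ¬px
... | no ¬px | no ¬qx = count-cong P? Q? xs (P⇔Q ∘ there)

≡-cong-⇔ : ∀ {x x′ y y′ : X} → x ≡ x′ → y ≡ y′ → (x ≡ y) ⇔ (x′ ≡ y′)
≡-cong-⇔ refl refl = ⇔-id _

+-cancelˡ-⇔ : ∀ k {m n} → (k + m ≡ k + n) ⇔ (m ≡ n)
+-cancelˡ-⇔ k = mk⇔ (+-cancelˡ-≡ k _ _) (cong (k +_))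

+-cancelʳ-⇔ : ∀ k {m n} → (m + k ≡ n + k) ⇔ (m ≡ n)
+-cancelʳ-⇔ k = mk⇔ (+-cancelʳ-≡ k _ _) (cong (_+ k))

m+1≡1+n⇔m≡n : ∀ m n → (m + 1 ≡ suc n) ⇔ (m ≡ n)
m+1≡1+n⇔m≡n m n = mk⇔ (λ e → suc-injective (trans (+-comm 1 m) e)) (λ { refl → +-comm m 1 })

m⊓1+n≡1+m⊓n⇔m≡n : ∀ m n → (m ⊓ suc n ≡ suc m ⊓ n) ⇔ (m ≡ n)
m⊓1+n≡1+m⊓n⇔m≡n m n =
  mk⇔ (to m n) λ { refl → trans (m≤n⇒m⊓n≡m (n≤1+n m)) (sym (m≥n⇒m⊓n≡n (n≤1+n m))) }
  where
  to : ∀ m n → m ⊓ suc n ≡ suc m ⊓ n → m ≡ n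
  to zero    zero    _ = refl
  to zero    (suc n) ()
  to (suc m) zero    ()
  to (suc m) (suc n) e = cong suc (to m n (suc-injective e))

i-j≡k-l⇔i+l≡k+j : ∀ (i j k l : ℤ) → (i ℤ.- j ≡ k ℤ.- l) ⇔ (i ℤ.+ l ≡ k ℤ.+ j)
i-j≡k-l⇔i+l≡k+j i j k l = mk⇔ to from
  where
  open ≡-Reasoning
  to : i ℤ.- j ≡ k ℤ.- l → i ℤ.+ l ≡ k ℤ.+ j
  to e = begin
    i ℤ.+ l                  ≡⟨ add-back i j l ⟩
    (i ℤ.- j) ℤ.+ (j ℤ.+ l)  ≡⟨ cong (ℤ._+ (j ℤ.+ l)) e ⟩
    (k ℤ.- l) ℤ.+ (j ℤ.+ l)  ≡⟨ cancel k l j ⟩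
    k ℤ.+ j                  ∎
    where
    add-back : ∀ i j l → i ℤ.+ l ≡ (i ℤ.- j) ℤ.+ (j ℤ.+ l)
    add-back = solve-∀
    cancel : ∀ k l j → (k ℤ.- l) ℤ.+ (j ℤ.+ l) ≡ k ℤ.+ j
    cancel = solve-∀
  from : i ℤ.+ l ≡ k ℤ.+ j → i ℤ.- j ≡ k ℤ.- l
  from e = begin
    i ℤ.- j                  ≡⟨ add-both i j l ⟩
    (i ℤ.+ l) ℤ.- (j ℤ.+ l)  ≡⟨ cong (ℤ._- (j ℤ.+ l)) e ⟩
    (k ℤ.+ j) ℤ.- (j ℤ.+ l)  ≡⟨ cancel k j l ⟩
    k ℤ.- l                  ∎
    where
    add-both : ∀ i j l → i ℤ.- j ≡ (i ℤ.+ l) ℤ.- (j ℤ.+ l)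
    add-both = solve-∀
    cancel : ∀ k j l → (k ℤ.+ j) ℤ.- (j ℤ.+ l) ≡ k ℤ.- l
    cancel = solve-∀

+m-+n≡+o-+p⇔m+p≡o+n : ∀ m n o p → (ℤ.+ m ℤ.- ℤ.+ n ≡ ℤ.+ o ℤ.- ℤ.+ p) ⇔ (m + p ≡ o + n)
+m-+n≡+o-+p⇔m+p≡o+n m n o p = ⇔-trans (i-j≡k-l⇔i+l≡k+j (ℤ.+ m) (ℤ.+ n) (ℤ.+ o) (ℤ.+ p))
  (mk⇔ (λ e → pos-injective (trans (pos-+ m p) (trans e (sym (pos-+ o n)))))
       (λ e → trans (sym (pos-+ m p)) (trans (cong ℤ.+_ e) (pos-+ o n))))

balance-⇔ : ∀ x y p q r s →
  (q + p + x ≡ r + s + y) ⇔ (ℤ.+ x ℤ.- ℤ.+ y ≡ ((ℤ.+ r ℤ.- ℤ.+ p) ℤ.+ ℤ.+ s) ℤ.- ℤ.+ q)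
balance-⇔ x y p q r s = begin
  (q + p + x ≡ r + s + y)
    ∼⟨ ≡-cong-⇔ (reorder q p x) refl ⟩
  (x + (p + q) ≡ (r + s) + y)
    ∼⟨ ⇔-sym (+m-+n≡+o-+p⇔m+p≡o+n x y (r + s) (p + q)) ⟩
  (ℤ.+ x ℤ.- ℤ.+ y ≡ ℤ.+ (r + s) ℤ.- ℤ.+ (p + q))
    ∼⟨ ≡-cong-⇔ refl rhs ⟩
  (ℤ.+ x ℤ.- ℤ.+ y ≡ ((ℤ.+ r ℤ.- ℤ.+ p) ℤ.+ ℤ.+ s) ℤ.- ℤ.+ q)
    ∎
  where
  open EquationalReasoning
  reorder : ∀ q p x → q + p + x ≡ x + (p + q)
  reorder = ℕ-Solver.solve-∀
  regroup : ∀ r s p q → (r ℤ.+ s) ℤ.- (p ℤ.+ q) ≡ ((r ℤ.- p) ℤ.+ s) ℤ.- q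
  regroup = solve-∀
  rhs : ℤ.+ (r + s) ℤ.- ℤ.+ (p + q) ≡ ((ℤ.+ r ℤ.- ℤ.+ p) ℤ.+ ℤ.+ s) ℤ.- ℤ.+ q
  rhs = trans (cong₂ ℤ._-_ (pos-+ r s) (pos-+ p q)) (regroup (ℤ.+ r) (ℤ.+ s) (ℤ.+ p) (ℤ.+ q))

Unique-++⁻ : ∀ (xs : List X) {ys} → Unique (xs ++ ys) → Unique xs × Unique ys × Disjoint xs ys
Unique-++⁻ []       u = [] , u , λ ()
Unique-++⁻ (x ∷ xs) (x≢ ∷ u) with Unique-++⁻ xs u
... | u-xs , u-ys , xs#ys = All.++⁻ˡ xs x≢ ∷ u-xs , u-ys , λ where
  (here refl , v∈ys)  → All.lookup (All.++⁻ʳ xs x≢) v∈ys refl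
  (there v∈xs , v∈ys) → xs#ys (v∈xs , v∈ys)

Unique-↭ : {xs ys : List X} → xs ↭ ys → Unique xs → Unique ys
Unique-↭ {X = X} xs↭ys = PermutationSetoid.Unique-resp-↭ (setoid X) (↭⇒↭ₛ xs↭ys)

minList-≤ : ∀ {ms m} → m ∈ ms → minList ms ≤ m
minList-≤ {k ∷ ks} {m} m∈ =
  foldr-preservesᵒ (λ x y → [ m≤n⇒m⊓o≤n y , m≤n⇒o⊓m≤n x ]′) k ks (start m∈)
  where
  start : m ∈ k ∷ ks → k ≤ m ⊎ Any (_≤ m) ks
  start (here refl)  = inj₁ ≤-refl
  start (there m∈ks) = inj₂ (Any.map (λ m≡x → ≤-reflexive (sym m≡x)) m∈ks)

minList-∈ : ∀ {ms m} → m ∈ ms → minList ms ∈ ms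
minList-∈ {k ∷ ks} _ = [ here , there ]′ (foldr-selective ⊓-sel k ks)

minList-≡ : ∀ {ms m} → m ∈ ms → (∀ {k} → k ∈ ms → m ≤ k) → minList ms ≡ m
minList-≡ m∈ m≤ = ≤-antisym (minList-≤ m∈) (m≤ (minList-∈ m∈))

-- Cross inversions

module _ {n : ℕ} where

  _≺[_]_ : Fin n → Ranking n → Fin n → Set
  y ≺[ ρ ] x = ρ ⟨$⟩ʳ y <ᶠ ρ ⟨$⟩ʳ x

  below? : (ρ : Ranking n) (x : Fin n) → Decidable (λ y → y ≺[ ρ ] x)
  below? ρ x y = ρ ⟨$⟩ʳ y <ᶠ? ρ ⟨$⟩ʳ x

  above? : (ρ : Ranking n) (y : Fin n) → Decidable (λ x → y ≺[ ρ ] x)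
  above? ρ y x = ρ ⟨$⟩ʳ y <ᶠ? ρ ⟨$⟩ʳ x

  module _ (ρ : Ranking n) where

    XInv-∷ˡ : ∀ x L M → XInv ρ (x ∷ L) M ≡ count (below? ρ x) M + XInv ρ L M
    XInv-∷ˡ x L M = length-++ (filter (below? ρ x) M)

    XInv-sum : ∀ L M → XInv ρ L M ≡ sum (map (λ x → count (below? ρ x) M) L)
    XInv-sum []      M = refl
    XInv-sum (x ∷ L) M = trans (XInv-∷ˡ x L M) (cong (count (below? ρ x) M +_) (XInv-sum L M))

    XInv-↭ˡ : ∀ {L L′} M → L ↭ L′ → XInv ρ L M ≡ XInv ρ L′ M
    XInv-↭ˡ {L} {L′} M L↭L′ = begin
      XInv ρ L M                                 ≡⟨ XInv-sum L M ⟩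
      sum (map (λ x → count (below? ρ x) M) L)  ≡⟨ sum-↭ (map⁺ _ L↭L′) ⟩
      sum (map (λ x → count (below? ρ x) M) L′) ≡⟨ XInv-sum L′ M ⟨
      XInv ρ L′ M                                ∎
      where open ≡-Reasoning

    XInv-↭ʳ : ∀ L {M M′} → M ↭ M′ → XInv ρ L M ≡ XInv ρ L M′
    XInv-↭ʳ []      M↭M′ = refl
    XInv-↭ʳ (x ∷ L) {M} {M′} M↭M′ = begin
      XInv ρ (x ∷ L) M                     ≡⟨ XInv-∷ˡ x L M ⟩
      count (below? ρ x) M  + XInv ρ L M   ≡⟨ cong₂ _+_ (count-↭ (below? ρ x) M↭M′) (XInv-↭ʳ L M↭M′) ⟩
      count (below? ρ x) M′ + XInv ρ L M′  ≡⟨ XInv-∷ˡ x L M′ ⟨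
      XInv ρ (x ∷ L) M′                    ∎
      where open ≡-Reasoning

    XInv-++ˡ : ∀ L₁ L₂ M → XInv ρ (L₁ ++ L₂) M ≡ XInv ρ L₁ M + XInv ρ L₂ M
    XInv-++ˡ L₁ L₂ M = begin
      XInv ρ (L₁ ++ L₂) M              ≡⟨ XInv-sum (L₁ ++ L₂) M ⟩
      sum (map f (L₁ ++ L₂))           ≡⟨ cong sum (map-++ f L₁ L₂) ⟩
      sum (map f L₁ ++ map f L₂)       ≡⟨ sum-++ (map f L₁) (map f L₂) ⟩
      sum (map f L₁) + sum (map f L₂)  ≡⟨ cong₂ _+_ (XInv-sum L₁ M) (XInv-sum L₂ M) ⟨
      XInv ρ L₁ M + XInv ρ L₂ M        ∎
      where
      open ≡-Reasoning
      f : Fin n → ℕ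
      f x = count (below? ρ x) M

    XInv-++ʳ : ∀ L M₁ M₂ → XInv ρ L (M₁ ++ M₂) ≡ XInv ρ L M₁ + XInv ρ L M₂
    XInv-++ʳ []      M₁ M₂ = refl
    XInv-++ʳ (x ∷ L) M₁ M₂ = begin
      XInv ρ (x ∷ L) (M₁ ++ M₂)
        ≡⟨ XInv-∷ˡ x L (M₁ ++ M₂) ⟩
      count (below? ρ x) (M₁ ++ M₂) + XInv ρ L (M₁ ++ M₂)
        ≡⟨ cong₂ _+_ (count-++ (below? ρ x) M₁ M₂) (XInv-++ʳ L M₁ M₂) ⟩
      (c₁ + c₂) + (XInv ρ L M₁ + XInv ρ L M₂)
        ≡⟨ interchange c₁ c₂ (XInv ρ L M₁) (XInv ρ L M₂) ⟩
      (c₁ + XInv ρ L M₁) + (c₂ + XInv ρ L M₂)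
        ≡⟨ cong₂ _+_ (XInv-∷ˡ x L M₁) (XInv-∷ˡ x L M₂) ⟨
      XInv ρ (x ∷ L) M₁ + XInv ρ (x ∷ L) M₂
        ∎
      where
      open ≡-Reasoning
      c₁ c₂ : ℕ
      c₁ = count (below? ρ x) M₁
      c₂ = count (below? ρ x) M₂
      interchange : ∀ a b c d → (a + b) + (c + d) ≡ (a + c) + (b + d)
      interchange = ℕ-Solver.solve-∀

    XInv-singletonˡ : ∀ x M → XInv ρ [ x ] M ≡ count (below? ρ x) M
    XInv-singletonˡ x M = trans (XInv-∷ˡ x [] M) (+-identityʳ _)

    XInv-singletonʳ : ∀ L y → XInv ρ L [ y ] ≡ count (above? ρ y) L
    XInv-singletonʳ []      y = refl
    XInv-singletonʳ (x ∷ L) y = begin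
      XInv ρ (x ∷ L) [ y ]                                       ≡⟨ XInv-∷ˡ x L [ y ] ⟩
      count (below? ρ x) [ y ] + XInv ρ L [ y ]                  ≡⟨ cong₂ _+_ same-test (XInv-singletonʳ L y) ⟩
      count (above? ρ y) [ x ] + count (above? ρ y) L            ≡⟨ count-++ (above? ρ y) [ x ] L ⟨
      count (above? ρ y) (x ∷ L)                                 ∎
      where
      open ≡-Reasoning
      same-test : count (below? ρ x) [ y ] ≡ count (above? ρ y) [ x ]
      same-test with does (ρ ⟨$⟩ʳ y <ᶠ? ρ ⟨$⟩ʳ x)
      ... | true  = refl
      ... | false = refl

    inversions-++ : ∀ σ τ → inversions ρ (σ ++ τ) ≡ inversions ρ σ + inversions ρ τ + XInv ρ σ τ
    inversions-++ []      τ = sym (+-identityʳ _)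
    inversions-++ (x ∷ σ) τ = begin
      count (below? ρ x) (σ ++ τ) + inversions ρ (σ ++ τ)
        ≡⟨ cong₂ _+_ (count-++ (below? ρ x) σ τ) (inversions-++ σ τ) ⟩
      (c₁ + c₂) + (inversions ρ σ + inversions ρ τ + XInv ρ σ τ)
        ≡⟨ regroup c₁ c₂ (inversions ρ σ) (inversions ρ τ) (XInv ρ σ τ) ⟩
      c₁ + inversions ρ σ + inversions ρ τ + (c₂ + XInv ρ σ τ)
        ≡⟨ cong (c₁ + inversions ρ σ + inversions ρ τ +_) (XInv-∷ˡ x σ τ) ⟨
      c₁ + inversions ρ σ + inversions ρ τ + XInv ρ (x ∷ σ) τ
        ∎
      where
      open ≡-Reasoning
      c₁ c₂ : ℕ
      c₁ = count (below? ρ x) σ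
      c₂ = count (below? ρ x) τ
      regroup : ∀ a b c d e → (a + b) + (c + d + e) ≡ a + c + d + (b + e)
      regroup = ℕ-Solver.solve-∀

  XInv-cong : ∀ (ρ π : Ranking n) L M → (∀ {x y} → x ∈ L → y ∈ M → y ≺[ ρ ] x ⇔ y ≺[ π ] x) →
              XInv ρ L M ≡ XInv π L M
  XInv-cong ρ π []      M same = refl
  XInv-cong ρ π (x ∷ L) M same = begin
    XInv ρ (x ∷ L) M                   ≡⟨ XInv-∷ˡ ρ x L M ⟩
    count (below? ρ x) M + XInv ρ L M  ≡⟨ cong₂ _+_ (count-cong (below? ρ x) (below? π x) M (same (here refl)))
                                                     (XInv-cong ρ π L M (same ∘ there)) ⟩
    count (below? π x) M + XInv π L M  ≡⟨ XInv-∷ˡ π x L M ⟨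
    XInv π (x ∷ L) M                   ∎
    where open ≡-Reasoning

  XInvOffPair : Ranking n → Fin n → List (Fin n) → Fin n → List (Fin n) → ℕ
  XInvOffPair ρ x A y B = XInv ρ [ x ] B + XInv ρ A [ y ] + XInv ρ A B

  XInv-∷-∷ : ∀ (ρ : Ranking n) x A y B → XInv ρ (x ∷ A) (y ∷ B) ≡ XInv ρ [ x ] [ y ] + XInvOffPair ρ x A y B
  XInv-∷-∷ ρ x A y B = begin
    XInv ρ ([ x ] ++ A) (y ∷ B)                                             ≡⟨ XInv-++ˡ ρ [ x ] A (y ∷ B) ⟩
    XInv ρ [ x ] ([ y ] ++ B) + XInv ρ A ([ y ] ++ B)                       ≡⟨ cong₂ _+_ (XInv-++ʳ ρ [ x ] [ y ] B)
                                                                                          (XInv-++ʳ ρ A [ y ] B) ⟩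
    (XInv ρ [ x ] [ y ] + XInv ρ [ x ] B) + (XInv ρ A [ y ] + XInv ρ A B)   ≡⟨ regroup (XInv ρ [ x ] [ y ]) _ _ _ ⟩
    XInv ρ [ x ] [ y ] + XInvOffPair ρ x A y B                              ∎
    where
    open ≡-Reasoning
    regroup : ∀ p q r s → (p + q) + (r + s) ≡ p + (q + r + s)
    regroup = ℕ-Solver.solve-∀

  XInv-↭-∷-∷ : ∀ (ρ : Ranking n) {L M x A y B} → L ↭ x ∷ A → M ↭ y ∷ B →
               XInv ρ L M ≡ XInv ρ [ x ] [ y ] + XInvOffPair ρ x A y B
  XInv-↭-∷-∷ ρ {L} {M} {x} {A} {y} {B} L↭ M↭ =
    trans (XInv-↭ˡ ρ M L↭) (trans (XInv-↭ʳ ρ (x ∷ A) M↭) (XInv-∷-∷ ρ x A y B))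

  XInv-singletons-≺ : ∀ (ρ : Ranking n) {x y} → y ≺[ ρ ] x → XInv ρ [ x ] [ y ] ≡ 1
  XInv-singletons-≺ ρ {x} {y} y≺x =
    trans (XInv-singletonˡ ρ x [ y ]) (cong length (filter-accept (below? ρ x) {xs = []} y≺x))

  XInv-singletons-⊀ : ∀ (ρ : Ranking n) {x y} → ¬ y ≺[ ρ ] x → XInv ρ [ x ] [ y ] ≡ 0
  XInv-singletons-⊀ ρ {x} {y} y⊀x =
    trans (XInv-singletonˡ ρ x [ y ]) (cong length (filter-reject (below? ρ x) {xs = []} y⊀x))

-- The minimum number of inversions at a binary node

module _ {n : ℕ} where

  orderings-node2⁻ : ∀ {s t : Tree n} {σ} → σ ∈ orderings (node2 s t) →
    ∃₂ λ σs σt → σs ∈ orderings s × σt ∈ orderings t × (σ ≡ σs ++ σt ⊎ σ ≡ σt ++ σs)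
  orderings-node2⁻ {s} {t} σ∈ with find (∈-concatMap⁻ _ {xs = orderings s} σ∈)
  ... | σs , σs∈ , σ∈′ with find (∈-concatMap⁻ _ {xs = orderings t} σ∈′)
  ...   | σt , σt∈ , here σ≡         = σs , σt , σs∈ , σt∈ , inj₁ σ≡
  ...   | σt , σt∈ , there (here σ≡) = σs , σt , σs∈ , σt∈ , inj₂ σ≡

  orderings-node2⁺ : ∀ {s t : Tree n} {σs σt} → σs ∈ orderings s → σt ∈ orderings t →
    σs ++ σt ∈ orderings (node2 s t) × σt ++ σs ∈ orderings (node2 s t)
  orderings-node2⁺ {s} {t} {σs} {σt} σs∈ σt∈ = pick (here refl) , pick (there (here refl))
    where
    pick : ∀ {σ} → σ ∈ (σs ++ σt) ∷ (σt ++ σs) ∷ [] → σ ∈ orderings (node2 s t)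
    pick σ∈ = ∈-concatMap⁺ _ {xs = orderings s} (lose σs∈ (∈-concatMap⁺ _ {xs = orderings t} (lose σt∈ σ∈)))

  orderings-↭ : ∀ (t : Tree n) {σ} → σ ∈ orderings t → σ ↭ leaves t
  orderings-↭ (leaf x)    (here refl) = ↭-refl
  orderings-↭ (node1 t)   σ∈          = orderings-↭ t σ∈
  orderings-↭ (node2 s t) σ∈ with orderings-node2⁻ {s = s} {t} σ∈
  ... | σs , σt , σs∈ , σt∈ , inj₁ refl = ++⁺ (orderings-↭ s σs∈) (orderings-↭ t σt∈)
  ... | σs , σt , σs∈ , σt∈ , inj₂ refl =
    ↭-trans (++-comm σt σs) (++⁺ (orderings-↭ s σs∈) (orderings-↭ t σt∈))

  some-ordering : ∀ (t : Tree n) → ∃ λ σ → σ ∈ orderings t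
  some-ordering (leaf x)    = _ , here refl
  some-ordering (node1 t)   = some-ordering t
  some-ordering (node2 s t) =
    _ , proj₁ (orderings-node2⁺ {s = s} {t} (proj₂ (some-ordering s)) (proj₂ (some-ordering t)))

  module _ (ρ : Ranking n) where

    MInv-≤ : ∀ (t : Tree n) {σ} → σ ∈ orderings t → MInv t ρ ≤ inversions ρ σ
    MInv-≤ t σ∈ = minList-≤ (∈-map⁺ (inversions ρ) σ∈)

    MInv-attained : ∀ (t : Tree n) → ∃ λ σ → σ ∈ orderings t × inversions ρ σ ≡ MInv t ρ
    MInv-attained t with ∈-map⁻ (inversions ρ) (minList-∈ (∈-map⁺ (inversions ρ) (proj₂ (some-ordering t))))
    ... | σ , σ∈ , MInv≡ = σ , σ∈ , sym MInv≡

    inversions-++-orderings : ∀ {s t : Tree n} {σs σt} → σs ∈ orderings s → σt ∈ orderings t →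
      inversions ρ (σs ++ σt) ≡ inversions ρ σs + inversions ρ σt + XInv ρ (leaves s) (leaves t)
    inversions-++-orderings {s} {t} {σs} {σt} σs∈ σt∈ =
      trans (inversions-++ ρ σs σt) (cong (inversions ρ σs + inversions ρ σt +_)
        (trans (XInv-↭ˡ ρ σt (orderings-↭ s σs∈)) (XInv-↭ʳ ρ (leaves s) (orderings-↭ t σt∈))))

    MInv-node2 : ∀ (s t : Tree n) → MInv (node2 s t) ρ ≡
      MInv s ρ + MInv t ρ + (XInv ρ (leaves s) (leaves t) ⊓ XInv ρ (leaves t) (leaves s))
    MInv-node2 s t = minList-≡ attained lower
      where
      X₁ X₂ : ℕ
      X₁ = XInv ρ (leaves s) (leaves t)
      X₂ = XInv ρ (leaves t) (leaves s)
      inv-st : ∀ {σs σt} → σs ∈ orderings s → σt ∈ orderings t →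
               inversions ρ (σs ++ σt) ≡ inversions ρ σs + inversions ρ σt + X₁
      inv-st = inversions-++-orderings {s} {t}
      inv-ts : ∀ {σs σt} → σs ∈ orderings s → σt ∈ orderings t →
               inversions ρ (σt ++ σs) ≡ inversions ρ σs + inversions ρ σt + X₂
      inv-ts {σs} {σt} σs∈ σt∈ =
        trans (inversions-++-orderings {t} {s} σt∈ σs∈) (cong (_+ X₂) (+-comm (inversions ρ σt) (inversions ρ σs)))
      attained : MInv s ρ + MInv t ρ + (X₁ ⊓ X₂) ∈ map (inversions ρ) (orderings (node2 s t))
      attained with MInv-attained s | MInv-attained t | ⊓-sel X₁ X₂
      ... | σs , σs∈ , σs-opt | σt , σt∈ , σt-opt | inj₁ min≡X₁ =
        subst (_∈ _) (trans (inv-st σs∈ σt∈) (cong₂ _+_ (cong₂ _+_ σs-opt σt-opt) (sym min≡X₁)))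
          (∈-map⁺ (inversions ρ) (proj₁ (orderings-node2⁺ {s = s} {t} σs∈ σt∈)))
      ... | σs , σs∈ , σs-opt | σt , σt∈ , σt-opt | inj₂ min≡X₂ =
        subst (_∈ _) (trans (inv-ts σs∈ σt∈) (cong₂ _+_ (cong₂ _+_ σs-opt σt-opt) (sym min≡X₂)))
          (∈-map⁺ (inversions ρ) (proj₂ (orderings-node2⁺ {s = s} {t} σs∈ σt∈)))
      lower : ∀ {k} → k ∈ map (inversions ρ) (orderings (node2 s t)) → MInv s ρ + MInv t ρ + (X₁ ⊓ X₂) ≤ k
      lower k∈ with ∈-map⁻ (inversions ρ) k∈
      ... | σ , σ∈ , refl with orderings-node2⁻ {s = s} {t} σ∈
      ...   | σs , σt , σs∈ , σt∈ , inj₁ refl = subst (_ ≤_) (sym (inv-st σs∈ σt∈))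
                (+-mono-≤ (+-mono-≤ (MInv-≤ s σs∈) (MInv-≤ t σt∈)) (m⊓n≤m X₁ X₂))
      ...   | σs , σt , σs∈ , σt∈ , inj₂ refl = subst (_ ≤_) (sym (inv-ts σs∈ σt∈))
                (+-mono-≤ (+-mono-≤ (MInv-≤ s σs∈) (MInv-≤ t σt∈)) (m⊓n≤n X₁ X₂))

    MInv-node2-comm : ∀ (s t : Tree n) → MInv (node2 s t) ρ ≡ MInv (node2 t s) ρ
    MInv-node2-comm s t = trans (MInv-node2 s t)
      (trans (cong₂ _+_ (+-comm (MInv s ρ) (MInv t ρ)) (⊓-comm _ _)) (sym (MInv-node2 t s)))

-- Subtrees and lowest common ancestors

module _ {n : ℕ} where

  ∈-remove⁻ : ∀ {x y : Fin n} L → y ∈ remove x L → y ∈ L × y ≢ x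
  ∈-remove⁻ {x} L = ∈-filter⁻ (λ z → ¬? (z ≟ᶠ x)) {xs = L}

  remove-↭ : ∀ {x : Fin n} {L} → Unique L → x ∈ L → L ↭ x ∷ remove x L
  remove-↭ {L = y ∷ L} (y≢ ∷ _) (here refl) = ↭-reflexive (cong (y ∷_) (sym remove-head))
    where
    remove-head : remove y (y ∷ L) ≡ L
    remove-head = trans (filter-reject (λ z → ¬? (z ≟ᶠ y)) (λ y≢y → y≢y refl))
                        (filter-all (λ z → ¬? (z ≟ᶠ y)) (All.map (λ y≢z z≡y → y≢z (sym z≡y)) y≢))
  remove-↭ {x} {y ∷ L} (y≢ ∷ u) (there x∈L) =
    ↭-trans (↭-prep y (remove-↭ u x∈L))
            (↭-trans (↭-swap y x ↭-refl) (↭-reflexive (cong (x ∷_) (sym remove-tail))))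
    where
    remove-tail : remove x (y ∷ L) ≡ y ∷ remove x L
    remove-tail = filter-accept (λ z → ¬? (z ≟ᶠ x)) (All.lookup y≢ x∈L)

  size : Tree n → ℕ
  size (leaf x)    = 1
  size (node1 t)   = suc (size t)
  size (node2 s t) = suc (size s + size t)

  size-child : ∀ {c t : Tree n} → ChildOf c t → size c < size t
  size-child child1            = ≤-refl
  size-child (child2l {s} {t}) = s≤s (m≤m+n (size s) (size t))
  size-child (child2r {s} {t}) = s≤s (m≤n+m (size t) (size s))

  size-⊑ : ∀ {u t : Tree n} → u ⊑ t → size u ≤ size t
  size-⊑ here          = ≤-refl
  size-⊑ (below u⊑c c) = ≤-trans (size-⊑ u⊑c) (<⇒≤ (size-child c))

  ⊑-trans : ∀ {u v w : Tree n} → u ⊑ v → v ⊑ w → u ⊑ w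
  ⊑-trans u⊑v here          = u⊑v
  ⊑-trans u⊑v (below v⊑c c) = below (⊑-trans u⊑v v⊑c) c

  child-⋢ : ∀ {c t : Tree n} → ChildOf c t → ¬ (t ⊑ c)
  child-⋢ c t⊑c = <-irrefl refl (≤-<-trans (size-⊑ t⊑c) (size-child c))

  leaves-⊑ : ∀ {u t : Tree n} {x} → u ⊑ t → x ∈ leaves u → x ∈ leaves t
  leaves-⊑ here                      x∈ = x∈
  leaves-⊑ (below u⊑c child1)        x∈ = leaves-⊑ u⊑c x∈
  leaves-⊑ (below u⊑c child2l)       x∈ = ∈-++⁺ˡ (leaves-⊑ u⊑c x∈)
  leaves-⊑ (below u⊑c (child2r {s})) x∈ = ∈-++⁺ʳ (leaves s) (leaves-⊑ u⊑c x∈)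

  Unique-⊑ : ∀ {u t : Tree n} → u ⊑ t → Unique (leaves t) → Unique (leaves u)
  Unique-⊑ here                      u-t = u-t
  Unique-⊑ (below u⊑c child1)        u-t = Unique-⊑ u⊑c u-t
  Unique-⊑ (below u⊑c (child2l {s})) u-t = Unique-⊑ u⊑c (proj₁ (Unique-++⁻ (leaves s) u-t))
  Unique-⊑ (below u⊑c (child2r {s})) u-t = Unique-⊑ u⊑c (proj₁ (proj₂ (Unique-++⁻ (leaves s) u-t)))

  IsSplitInto : Tree n → Tree n → Tree n → Set
  IsSplitInto v s t = v ≡ node2 s t ⊎ v ≡ node2 t s

  IsSplitInto-leaves : ∀ {v s t : Tree n} → IsSplitInto v s t → leaves v ↭ leaves s ++ leaves t
  IsSplitInto-leaves (inj₁ refl)             = ↭-refl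
  IsSplitInto-leaves {s = s} {t} (inj₂ refl) = ++-comm (leaves t) (leaves s)

  IsSplitInto-MInv : ∀ {v s t : Tree n} → IsSplitInto v s t → ∀ ρ → MInv v ρ ≡ MInv (node2 s t) ρ
  IsSplitInto-MInv (inj₁ refl)             ρ = refl
  IsSplitInto-MInv {s = s} {t} (inj₂ refl) ρ = MInv-node2-comm ρ t s

  lca-child-separates : ∀ {T v c : Tree n} {a b} → IsLCA T v a b → ChildOf c v → ¬ (a ∈ leaves c × b ∈ leaves c)
  lca-child-separates lca c (a∈ , b∈) =
    child-⋢ c (IsLCA.lowest lca _ (⊑-trans (below here c) (IsLCA.isNode lca)) a∈ b∈)

  lca-splits : ∀ {T v ulo uhi : Tree n} {a b} → IsLCA T v a b → ChildOf ulo v → ChildOf uhi v →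
               a ∈ leaves ulo → b ∈ leaves uhi → IsSplitInto v ulo uhi
  lca-splits lca child1  child1  a∈ b∈ = contradiction (a∈ , b∈) (lca-child-separates lca child1)
  lca-splits lca child2l child2l a∈ b∈ = contradiction (a∈ , b∈) (lca-child-separates lca child2l)
  lca-splits lca child2r child2r a∈ b∈ = contradiction (a∈ , b∈) (lca-child-separates lca child2r)
  lca-splits lca child2l child2r _  _  = inj₁ refl
  lca-splits lca child2r child2l _  _  = inj₂ refl

-- Rankings that order all pairs alike except one

module _ {n : ℕ} where

  SameOrderExcept : Ranking n → Ranking n → Fin n → Fin n → Set
  SameOrderExcept ρ π a b =
    ∀ x y → ¬ (x ≡ a × y ≡ b) → ¬ (x ≡ b × y ≡ a) → y ≺[ ρ ] x ⇔ y ≺[ π ] x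

  module SameOrder {ρ π : Ranking n} {a b : Fin n} (same : SameOrderExcept ρ π a b) where

    XInv-same : ∀ L M → ¬ (a ∈ L × b ∈ M) → ¬ (b ∈ L × a ∈ M) → XInv ρ L M ≡ XInv π L M
    XInv-same L M ab∉ ba∉ = XInv-cong ρ π L M λ {x} {y} x∈ y∈ →
      same x y (λ { (refl , refl) → ab∉ (x∈ , y∈) }) (λ { (refl , refl) → ba∉ (x∈ , y∈) })

    MInv-same : ∀ (w : Tree n) → ¬ (a ∈ leaves w × b ∈ leaves w) → MInv w ρ ≡ MInv w π
    MInv-same (leaf x)    _   = refl
    MInv-same (node1 w)   ab∉ = MInv-same w ab∉
    MInv-same (node2 s t) ab∉ = begin
      MInv (node2 s t) ρ
        ≡⟨ MInv-node2 ρ s t ⟩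
      MInv s ρ + MInv t ρ + (XInv ρ (leaves s) (leaves t) ⊓ XInv ρ (leaves t) (leaves s))
        ≡⟨ cong₂ _+_ (cong₂ _+_ (MInv-same s (ab∉ ∘ inˡ)) (MInv-same t (ab∉ ∘ inʳ)))
                     (cong₂ _⊓_ (XInv-same (leaves s) (leaves t) (ab∉ ∘ across) (ab∉ ∘ swap ∘ across))
                                (XInv-same (leaves t) (leaves s) (ab∉ ∘ swap ∘ across ∘ swap) (ab∉ ∘ across ∘ swap))) ⟩
      MInv s π + MInv t π + (XInv π (leaves s) (leaves t) ⊓ XInv π (leaves t) (leaves s))
        ≡⟨ MInv-node2 π s t ⟨
      MInv (node2 s t) π
        ∎
      where
      open ≡-Reasoning
      inˡ : ∀ {x y} → x ∈ leaves s × y ∈ leaves s → x ∈ leaves (node2 s t) × y ∈ leaves (node2 s t)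
      inˡ = Product.map ∈-++⁺ˡ ∈-++⁺ˡ
      inʳ : ∀ {x y} → x ∈ leaves t × y ∈ leaves t → x ∈ leaves (node2 s t) × y ∈ leaves (node2 s t)
      inʳ = Product.map (∈-++⁺ʳ (leaves s)) (∈-++⁺ʳ (leaves s))
      across : ∀ {x y} → x ∈ leaves s × y ∈ leaves t → x ∈ leaves (node2 s t) × y ∈ leaves (node2 s t)
      across = Product.map ∈-++⁺ˡ (∈-++⁺ʳ (leaves s))

    MInv-beside-⇔ : ∀ (c t : Tree n) → Disjoint (leaves c) (leaves t) → a ∈ leaves c → b ∈ leaves c →
                    (MInv (node2 c t) ρ ≡ MInv (node2 c t) π) ⇔ (MInv c ρ ≡ MInv c π)
    MInv-beside-⇔ c t c#t a∈c b∈c = begin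
      (MInv (node2 c t) ρ ≡ MInv (node2 c t) π)
        ∼⟨ ≡-cong-⇔ (split ρ) (trans (split π) (cong (MInv c π +_) (sym rest-same))) ⟩
      (MInv c ρ + rest ρ ≡ MInv c π + rest ρ)
        ∼⟨ +-cancelʳ-⇔ (rest ρ) ⟩
      (MInv c ρ ≡ MInv c π)
        ∎
      where
      open EquationalReasoning
      rest : Ranking n → ℕ
      rest σ = MInv t σ + (XInv σ (leaves c) (leaves t) ⊓ XInv σ (leaves t) (leaves c))
      split : ∀ σ → MInv (node2 c t) σ ≡ MInv c σ + rest σ
      split σ = trans (MInv-node2 σ c t) (+-assoc (MInv c σ) _ _)
      a∉t : a ∉ leaves t
      a∉t a∈t = c#t (a∈c , a∈t)
      b∉t : b ∉ leaves t
      b∉t b∈t = c#t (b∈c , b∈t)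
      rest-same : rest ρ ≡ rest π
      rest-same = cong₂ _+_ (MInv-same t (a∉t ∘ proj₁))
        (cong₂ _⊓_ (XInv-same (leaves c) (leaves t) (b∉t ∘ proj₂) (a∉t ∘ proj₂))
                   (XInv-same (leaves t) (leaves c) (a∉t ∘ proj₁) (b∉t ∘ proj₁)))

    MInv-ancestor-⇔ : ∀ {v w : Tree n} → v ⊑ w → Unique (leaves w) → a ∈ leaves v → b ∈ leaves v →
                      (MInv w ρ ≡ MInv w π) ⇔ (MInv v ρ ≡ MInv v π)
    MInv-ancestor-⇔ here _ _ _ = ⇔-id _
    MInv-ancestor-⇔ (below v⊑c child1) u-w a∈v b∈v = MInv-ancestor-⇔ v⊑c u-w a∈v b∈v
    MInv-ancestor-⇔ (below {c = c} v⊑c (child2l {t = t})) u-w a∈v b∈v =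
      let u-c , _ , c#t = Unique-++⁻ (leaves c) u-w in
      ⇔-trans (MInv-beside-⇔ c t c#t (leaves-⊑ v⊑c a∈v) (leaves-⊑ v⊑c b∈v))
              (MInv-ancestor-⇔ v⊑c u-c a∈v b∈v)
    MInv-ancestor-⇔ (below {c = c} v⊑c (child2r {s = s})) u-w a∈v b∈v =
      let _ , u-c , s#c = Unique-++⁻ (leaves s) u-w in
      ⇔-trans (≡-cong-⇔ (MInv-node2-comm ρ s c) (MInv-node2-comm π s c))
        (⇔-trans (MInv-beside-⇔ c s (s#c ∘ swap) (leaves-⊑ v⊑c a∈v) (leaves-⊑ v⊑c b∈v))
                 (MInv-ancestor-⇔ v⊑c u-c a∈v b∈v))

  record Consecutive (ρ : Ranking n) (a b : Fin n) : Set where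
    field
      below-⇔ : ∀ {z} → z ≢ a → z ≺[ ρ ] a ⇔ z ≺[ ρ ] b
      above-⇔ : ∀ {z} → z ≢ b → a ≺[ ρ ] z ⇔ b ≺[ ρ ] z

  module Split {s t : Tree n} {a b : Fin n} (u-st : Unique (leaves s ++ leaves t))
               (a∈s : a ∈ leaves s) (b∈t : b ∈ leaves t) where

    A B : List (Fin n)
    A = remove a (leaves s)
    B = remove b (leaves t)

    private
      s#t : Disjoint (leaves s) (leaves t)
      s#t = proj₂ (proj₂ (Unique-++⁻ (leaves s) u-st))

      s↭ : leaves s ↭ a ∷ A
      s↭ = remove-↭ (proj₁ (Unique-++⁻ (leaves s) u-st)) a∈s

      t↭ : leaves t ↭ b ∷ B
      t↭ = remove-↭ (proj₁ (proj₂ (Unique-++⁻ (leaves s) u-st))) b∈t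

      a∉A : a ∉ A
      a∉A a∈A = proj₂ (∈-remove⁻ (leaves s) a∈A) refl

      b∉B : b ∉ B
      b∉B b∈B = proj₂ (∈-remove⁻ (leaves t) b∈B) refl

      b∉A : b ∉ A
      b∉A b∈A = s#t (proj₁ (∈-remove⁻ (leaves s) b∈A) , b∈t)

      a∉B : a ∉ B
      a∉B a∈B = s#t (a∈s , proj₁ (∈-remove⁻ (leaves t) a∈B))

    offPair-st offPair-ts : Ranking n → ℕ
    offPair-st ρ = XInvOffPair ρ a A b B
    offPair-ts ρ = XInvOffPair ρ b B a A

    DInv-split-⇔ : ∀ {ρ} → a ≺[ ρ ] b →
                   (DInv ρ (leaves s) (leaves t) ≡ DInv ρ [ a ] [ b ]) ⇔ (offPair-st ρ ≡ offPair-ts ρ)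
    DInv-split-⇔ {ρ} a≺b = begin
      (DInv ρ (leaves s) (leaves t) ≡ DInv ρ [ a ] [ b ])
        ∼⟨ ≡-cong-⇔ (cong₂ (λ i j → ℤ.+ i ℤ.- ℤ.+ j) st ts) ab ⟩
      (ℤ.+ offPair-st ρ ℤ.- ℤ.+ suc (offPair-ts ρ) ≡ ℤ.+ 0 ℤ.- ℤ.+ 1)
        ∼⟨ +m-+n≡+o-+p⇔m+p≡o+n (offPair-st ρ) (suc (offPair-ts ρ)) 0 1 ⟩
      (offPair-st ρ + 1 ≡ suc (offPair-ts ρ))
        ∼⟨ m+1≡1+n⇔m≡n (offPair-st ρ) (offPair-ts ρ) ⟩
      (offPair-st ρ ≡ offPair-ts ρ)
        ∎
      where
      open EquationalReasoning
      b⊀a : ¬ b ≺[ ρ ] a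
      b⊀a = <-asym a≺b
      st : XInv ρ (leaves s) (leaves t) ≡ offPair-st ρ
      st = trans (XInv-↭-∷-∷ ρ s↭ t↭) (cong (_+ offPair-st ρ) (XInv-singletons-⊀ ρ b⊀a))
      ts : XInv ρ (leaves t) (leaves s) ≡ suc (offPair-ts ρ)
      ts = trans (XInv-↭-∷-∷ ρ t↭ s↭) (cong (_+ offPair-ts ρ) (XInv-singletons-≺ ρ a≺b))
      ab : DInv ρ [ a ] [ b ] ≡ ℤ.+ 0 ℤ.- ℤ.+ 1
      ab = cong₂ (λ i j → ℤ.+ i ℤ.- ℤ.+ j) (XInv-singletons-⊀ ρ b⊀a) (XInv-singletons-≺ ρ a≺b)

    module _ {ρ π : Ranking n} (same : SameOrderExcept ρ π a b) where
      open SameOrder {ρ = ρ} {π = π} {a = a} {b = b} same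

      XInvOffPair-same : ∀ x {A′ B′} y → a ∉ A′ → b ∉ A′ → a ∉ B′ → b ∉ B′ →
                         XInvOffPair ρ x A′ y B′ ≡ XInvOffPair π x A′ y B′
      XInvOffPair-same x {A′} {B′} y a∉A′ b∉A′ a∉B′ b∉B′ =
        cong₂ _+_ (cong₂ _+_ (XInv-same [ x ] B′ (b∉B′ ∘ proj₂) (a∉B′ ∘ proj₂))
                             (XInv-same A′ [ y ] (a∉A′ ∘ proj₁) (b∉A′ ∘ proj₁)))
                  (XInv-same A′ B′ (a∉A′ ∘ proj₁) (b∉A′ ∘ proj₁))

      MInv-split-⇔ : a ≺[ ρ ] b → b ≺[ π ] a →
                     (MInv (node2 s t) ρ ≡ MInv (node2 s t) π) ⇔ (offPair-st ρ ≡ offPair-ts ρ)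
      MInv-split-⇔ a≺b b≺a = begin
        (MInv (node2 s t) ρ ≡ MInv (node2 s t) π)
          ∼⟨ ≡-cong-⇔ (MInv-node2 ρ s t) MInv-π ⟩
        (S + (XInv ρ (leaves s) (leaves t) ⊓ XInv ρ (leaves t) (leaves s))
          ≡ S + (XInv π (leaves s) (leaves t) ⊓ XInv π (leaves t) (leaves s)))
          ∼⟨ ≡-cong-⇔ (cong (S +_) (cong₂ _⊓_ stρ tsρ)) (cong (S +_) (cong₂ _⊓_ stπ tsπ)) ⟩
        (S + (k₁ ⊓ suc k₂) ≡ S + (suc k₁ ⊓ k₂))
          ∼⟨ +-cancelˡ-⇔ S ⟩
        (k₁ ⊓ suc k₂ ≡ suc k₁ ⊓ k₂)
          ∼⟨ m⊓1+n≡1+m⊓n⇔m≡n k₁ k₂ ⟩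
        (k₁ ≡ k₂)
          ∎
        where
        open EquationalReasoning
        k₁ k₂ S : ℕ
        k₁ = offPair-st ρ
        k₂ = offPair-ts ρ
        S = MInv s ρ + MInv t ρ
        MInv-π : MInv (node2 s t) π ≡ S + (XInv π (leaves s) (leaves t) ⊓ XInv π (leaves t) (leaves s))
        MInv-π = trans (MInv-node2 π s t)
          (cong (_+ (XInv π (leaves s) (leaves t) ⊓ XInv π (leaves t) (leaves s)))
                (cong₂ _+_ (sym (MInv-same s λ (_ , b∈s) → s#t (b∈s , b∈t)))
                           (sym (MInv-same t λ (a∈t , _) → s#t (a∈s , a∈t)))))
        stρ : XInv ρ (leaves s) (leaves t) ≡ k₁
        stρ = trans (XInv-↭-∷-∷ ρ s↭ t↭) (cong (_+ k₁) (XInv-singletons-⊀ ρ (<-asym a≺b)))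
        tsρ : XInv ρ (leaves t) (leaves s) ≡ suc k₂
        tsρ = trans (XInv-↭-∷-∷ ρ t↭ s↭) (cong (_+ k₂) (XInv-singletons-≺ ρ a≺b))
        stπ : XInv π (leaves s) (leaves t) ≡ suc k₁
        stπ = trans (XInv-↭-∷-∷ π s↭ t↭)
                    (cong₂ _+_ (XInv-singletons-≺ π b≺a) (sym (XInvOffPair-same a b a∉A b∉A a∉B b∉B)))
        tsπ : XInv π (leaves t) (leaves s) ≡ k₂
        tsπ = trans (XInv-↭-∷-∷ π t↭ s↭)
                    (cong₂ _+_ (XInv-singletons-⊀ π (<-asym b≺a)) (sym (XInvOffPair-same b a a∉B b∉B a∉A b∉A)))

    offPair-balance-⇔ : ∀ {ρ} → Consecutive ρ a b →
      (offPair-st ρ ≡ offPair-ts ρ)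
        ⇔ (DInv ρ A B ≡ (((ℤ.+ length (below< ρ a A)) ℤ.- (ℤ.+ length (above> ρ a A)))
                         ℤ.+ (ℤ.+ length (above> ρ b B))) ℤ.- (ℤ.+ length (below< ρ b B)))
    offPair-balance-⇔ {ρ} consecutive =
      ⇔-trans (≡-cong-⇔ (cong₂ _+_ (cong₂ _+_ aB Ab) refl) (cong₂ _+_ (cong₂ _+_ bA Ba) refl))
              (balance-⇔ (XInv ρ A B) (XInv ρ B A) (length (above> ρ a A)) (length (below< ρ b B))
                                                   (length (below< ρ a A)) (length (above> ρ b B)))
      where
      open Consecutive consecutive
      ≢a : ∀ {L z} → a ∉ L → z ∈ L → z ≢ a
      ≢a a∉L z∈L refl = a∉L z∈L
      ≢b : ∀ {L z} → b ∉ L → z ∈ L → z ≢ b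
      ≢b b∉L z∈L refl = b∉L z∈L
      aB : XInv ρ [ a ] B ≡ length (below< ρ b B)
      aB = trans (XInv-singletonˡ ρ a B) (count-cong (below? ρ a) (below? ρ b) B (below-⇔ ∘ ≢a a∉B))
      Ab : XInv ρ A [ b ] ≡ length (above> ρ a A)
      Ab = trans (XInv-singletonʳ ρ A b) (count-cong (above? ρ b) (above? ρ a) A (⇔-sym ∘ above-⇔ ∘ ≢b b∉A))
      bA : XInv ρ [ b ] A ≡ length (below< ρ a A)
      bA = trans (XInv-singletonˡ ρ b A) (count-cong (below? ρ b) (below? ρ a) A (⇔-sym ∘ below-⇔ ∘ ≢a a∉A))
      Ba : XInv ρ B [ a ] ≡ length (above> ρ b B)
      Ba = trans (XInv-singletonʳ ρ B a) (count-cong (above? ρ a) (above? ρ b) B (above-⇔ ∘ ≢b b∉B))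

-- Transposing two adjacent ranks

module AdjacentTransposition {n : ℕ} {lo hi : Fin n} (hi≡1+lo : toℕ hi ≡ suc (toℕ lo)) where

  lo<hi : lo <ᶠ hi
  lo<hi rewrite hi≡1+lo = n<1+n (toℕ lo)

  hi≢lo : hi ≢ lo
  hi≢lo hi≡lo = <-irrefl (cong toℕ (sym hi≡lo)) lo<hi

  below-lo⇔below-hi : ∀ {k} → k ≢ lo → k <ᶠ lo ⇔ k <ᶠ hi
  below-lo⇔below-hi {k} k≢lo rewrite hi≡1+lo =
    mk⇔ m<n⇒m<1+n (λ k<1+lo → ≤∧≢⇒< (≤-pred k<1+lo) (k≢lo ∘ toℕ-injective))

  above-lo⇔above-hi : ∀ {k} → k ≢ hi → lo <ᶠ k ⇔ hi <ᶠ k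
  above-lo⇔above-hi {k} k≢hi rewrite hi≡1+lo =
    mk⇔ (λ lo<k → ≤∧≢⇒< lo<k (λ 1+lo≡k → k≢hi (toℕ-injective (trans (sym 1+lo≡k) (sym hi≡1+lo)))))
        (<-trans (n<1+n (toℕ lo)))

  private
    t : Fin n → Fin n
    t = PC.transpose lo hi

  t-lo : t lo ≡ hi
  t-lo rewrite dec-true (lo ≟ᶠ lo) refl = refl

  t-hi : t hi ≡ lo
  t-hi rewrite dec-false (hi ≟ᶠ lo) hi≢lo | dec-true (hi ≟ᶠ hi) refl = refl

  t-fixed : ∀ {k} → k ≢ lo → k ≢ hi → t k ≡ k
  t-fixed {k} k≢lo k≢hi rewrite dec-false (k ≟ᶠ lo) k≢lo | dec-false (k ≟ᶠ hi) k≢hi = refl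

  data TransposeView (k : Fin n) : Set where
    at-lo : k ≡ lo → t k ≡ hi → TransposeView k
    at-hi : k ≡ hi → t k ≡ lo → TransposeView k
    fixed : k ≢ lo → k ≢ hi → t k ≡ k → TransposeView k

  transposeView : ∀ k → TransposeView k
  transposeView k with k ≟ᶠ lo | k ≟ᶠ hi
  ... | yes refl | _        = at-lo refl t-lo
  ... | no k≢lo  | yes refl = at-hi refl t-hi
  ... | no k≢lo  | no k≢hi  = fixed k≢lo k≢hi (t-fixed k≢lo k≢hi)

  transpose-<-⇔ : ∀ i j → ¬ (i ≡ lo × j ≡ hi) → ¬ (i ≡ hi × j ≡ lo) → j <ᶠ i ⇔ t j <ᶠ t i
  transpose-<-⇔ i j ¬lohi ¬hilo with transposeView i | transposeView j
  ... | at-lo refl _    | at-lo refl _    = mk⇔ (⊥-elim ∘ <-irrefl refl) (⊥-elim ∘ <-irrefl refl)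
  ... | at-lo refl _    | at-hi refl _    = contradiction (refl , refl) ¬lohi
  ... | at-lo refl ti   | fixed j≢lo _ tj rewrite ti | tj = below-lo⇔below-hi j≢lo
  ... | at-hi refl _    | at-lo refl _    = contradiction (refl , refl) ¬hilo
  ... | at-hi refl _    | at-hi refl _    = mk⇔ (⊥-elim ∘ <-irrefl refl) (⊥-elim ∘ <-irrefl refl)
  ... | at-hi refl ti   | fixed j≢lo _ tj rewrite ti | tj = ⇔-sym (below-lo⇔below-hi j≢lo)
  ... | fixed _ i≢hi ti | at-lo refl tj   rewrite ti | tj = above-lo⇔above-hi i≢hi
  ... | fixed _ i≢hi ti | at-hi refl tj   rewrite ti | tj = ⇔-sym (above-lo⇔above-hi i≢hi)
  ... | fixed _ _ ti    | fixed _ _ tj    rewrite ti | tj = ⇔-id _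

  module _ (ρ : Ranking n) where

    private
      ℓlo ℓhi : Fin n
      ℓlo = ρ ⟨$⟩ˡ lo
      ℓhi = ρ ⟨$⟩ˡ hi

      ranked : ∀ {x k} → ρ ⟨$⟩ʳ x ≡ k → x ≡ ρ ⟨$⟩ˡ k
      ranked ρx≡k = trans (sym (inverseˡ ρ)) (cong (ρ ⟨$⟩ˡ_) ρx≡k)

    consecutive : Consecutive ρ ℓlo ℓhi
    consecutive = record
      { below-⇔ = λ {z} z≢ℓlo →
          subst₂ (λ i j → ρ ⟨$⟩ʳ z <ᶠ i ⇔ ρ ⟨$⟩ʳ z <ᶠ j) (sym (inverseʳ ρ)) (sym (inverseʳ ρ))
                 (below-lo⇔below-hi (z≢ℓlo ∘ ranked))
      ; above-⇔ = λ {z} z≢ℓhi →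
          subst₂ (λ i j → i <ᶠ ρ ⟨$⟩ʳ z ⇔ j <ᶠ ρ ⟨$⟩ʳ z) (sym (inverseʳ ρ)) (sym (inverseʳ ρ))
                 (above-lo⇔above-hi (z≢ℓhi ∘ ranked))
      }

    ℓlo≺ℓhi : ℓlo ≺[ ρ ] ℓhi
    ℓlo≺ℓhi = subst₂ _<ᶠ_ (sym (inverseʳ ρ)) (sym (inverseʳ ρ)) lo<hi

    ℓhi≺ℓlo : ℓhi ≺[ transpose lo hi · ρ ] ℓlo
    ℓhi≺ℓlo = subst₂ _<ᶠ_ (sym (trans (cong t (inverseʳ ρ)) t-hi)) (sym (trans (cong t (inverseʳ ρ)) t-lo))
                     lo<hi

    transpose-sameOrder : SameOrderExcept ρ (transpose lo hi · ρ) ℓlo ℓhi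
    transpose-sameOrder x y ¬lohi ¬hilo = transpose-<-⇔ (ρ ⟨$⟩ʳ x) (ρ ⟨$⟩ʳ y)
      (λ (x-lo , y-hi) → ¬lohi (ranked x-lo , ranked y-hi))
      (λ (x-hi , y-lo) → ¬hilo (ranked x-hi , ranked y-lo))

mainTheorem7 :
  ∀ (n : ℕ) (T : Tree n) → leaves T ↭ allFin n →
  ∀ (ρ : Ranking n) (r : ℕ) (r+1<n : suc r < n) →
  let lo = fromℕ< (<-trans (n<1+n r) r+1<n)
      hi = fromℕ< r+1<n
      ℓlo = ρ ⟨$⟩ˡ lo
      ℓhi = ρ ⟨$⟩ˡ hi
  in ∀ (v ulo uhi : Tree n) → IsLCA T v ℓlo ℓhi →
     ChildOf ulo v → ChildOf uhi v → ℓlo ∈ leaves ulo → ℓhi ∈ leaves uhi →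
     let Llo = leaves ulo
         Lhi = leaves uhi
         A = remove ℓlo Llo
         B = remove ℓhi Lhi
     in ((MInv T ρ ≡ MInv T (transpose lo hi · ρ))
          ⇔ (DInv ρ Llo Lhi ≡ DInv ρ [ ℓlo ] [ ℓhi ]))
        × ((DInv ρ Llo Lhi ≡ DInv ρ [ ℓlo ] [ ℓhi ])
          ⇔ (DInv ρ A B ≡ ((((ℤ.+ length (below< ρ ℓlo A)) ℤ.- (ℤ.+ length (above> ρ ℓlo A)))
                             ℤ.+ (ℤ.+ length (above> ρ ℓhi B))) ℤ.- (ℤ.+ length (below< ρ ℓhi B)))))
mainTheorem7 n T T↭allFin ρ r r+1<n v ulo uhi lca ulo-child uhi-child ℓlo∈ ℓhi∈ =
  ⇔-trans MInv-⇔ (⇔-sym DInv-⇔) , ⇔-trans DInv-⇔ (offPair-balance-⇔ (consecutive ρ))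
  where
  lo hi : Fin n
  lo = fromℕ< (<-trans (n<1+n r) r+1<n)
  hi = fromℕ< r+1<n
  open AdjacentTransposition {lo = lo} {hi = hi} (trans (toℕ-fromℕ< r+1<n) (cong suc (sym (toℕ-fromℕ< _))))
  open IsLCA lca
  unique-T : Unique (leaves T)
  unique-T = Unique-↭ (↭-sym T↭allFin) (allFin⁺ n)
  split : IsSplitInto v ulo uhi
  split = lca-splits lca ulo-child uhi-child ℓlo∈ ℓhi∈
  open Split {s = ulo} {t = uhi} (Unique-↭ (IsSplitInto-leaves split) (Unique-⊑ isNode unique-T)) ℓlo∈ ℓhi∈
  τρ : Ranking n
  τρ = transpose lo hi · ρ
  MInv-⇔ : (MInv T ρ ≡ MInv T τρ) ⇔ (offPair-st ρ ≡ offPair-ts ρ)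
  MInv-⇔ = begin
    (MInv T ρ ≡ MInv T τρ)
      ∼⟨ SameOrder.MInv-ancestor-⇔ (transpose-sameOrder ρ) isNode unique-T hasA hasB ⟩
    (MInv v ρ ≡ MInv v τρ)
      ∼⟨ ≡-cong-⇔ (IsSplitInto-MInv split ρ) (IsSplitInto-MInv split τρ) ⟩
    (MInv (node2 ulo uhi) ρ ≡ MInv (node2 ulo uhi) τρ)
      ∼⟨ MInv-split-⇔ (transpose-sameOrder ρ) (ℓlo≺ℓhi ρ) (ℓhi≺ℓlo ρ) ⟩
    (offPair-st ρ ≡ offPair-ts ρ)
      ∎
    where open EquationalReasoning
  DInv-⇔ : (DInv ρ (leaves ulo) (leaves uhi) ≡ DInv ρ [ ρ ⟨$⟩ˡ lo ] [ ρ ⟨$⟩ˡ hi ])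
           ⇔ (offPair-st ρ ≡ offPair-ts ρ)
  DInv-⇔ = DInv-split-⇔ {ρ = ρ} (ℓlo≺ℓhi ρ)
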